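{- Let $n,m$ be positive integers. Write $n=am+b$ with integers $a>0$ and $0<b<m$, and set $d=a+b$ and $k=\lfloor n/d\rfloor$. Let $\Delta$ be the regular configuration in $\mathrm{CONF}(a,b)$, with a fixed reading as in the context. Then for every integer $q$ with $1\le q\le k-1$, the cycles $C_{0,\Delta}$ and $C_{q(m-1),\Delta}$ have no common vertex.
   Context: $\mathrm{Shift}(n,m)$ is the directed graph with vertex set $\mathbb{Z}_n$ and arcs $i\to i+1$ and $i\to i+m$ (mod $n$). $\mathrm{CONF}(a,b)$ is the set of necklaces (circular arrangements up to rotation) of $a$ red and $b$ black beads. For a necklace with black beads $B_0,\dots,B_{b-1}$ in cyclic order, its characteristic sequence $\{x_0,\dots,x_{b-1}\}$ lists the number $x_i$ of red beads between $B_i$ and $B_{i+1}$. The necklace is regular if $\frac{a}{b}k'-1<x_i+\dots+x_{i+k'-1}<\frac{a}{b}k'+1$ for all $0\le i\le b-1$ and $1\le k'\le 1+\lfloor b/2\rfloor$ (indices mod $b$). There is a unique regular configuration in $\mathrm{CONF}(a,b)$. Fix a reading of $\Delta$: the beads $\beta_0,\dots,\beta_{d-1}$ in cyclic order from some starting bead. Set $l_p=m$ if $\beta_p$ is red and $l_p=1$ if black, so that $\sum_p l_p=n$. For $v\in\mathbb{Z}_n$, $C_{v,\Delta}$ is the cycle with vertex sequence $v,\ v+l_0,\ v+l_0+l_1,\ \dots,\ v+l_0+\dots+l_{d-2}$ (mod $n$), using the same reading for all $v$. -}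

module Defs where

open import Data.Nat using (ℕ; zero; suc; _+_; _*_; _∸_; _<_; _≤_; NonZero; s≤s; z≤n)
open import Data.Nat.DivMod using (_/_; _%_)
open import Data.List using (List; []; _∷_; length)
open import Data.Product using (_×_)

data Color : Set where
  red black : Color

countRed : List Color → ℕ
countRed [] = 0
countRed (red ∷ ws) = suc (countRed ws)
countRed (black ∷ ws) = countRed ws

countBlack : List Color → ℕ
countBlack [] = 0
countBlack (red ∷ ws) = countBlack ws
countBlack (black ∷ ws) = suc (countBlack ws)

leading : List Color → ℕ
leading [] = 0
leading (red ∷ ws) = suc (leading ws)
leading (black ∷ ws) = 0

gapsAfter : List Color → List ℕ
gapsAfter [] = []
gapsAfter (red ∷ ws) = gapsAfter ws
gapsAfter (black ∷ ws) = leading ws ∷ gapsAfter ws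

addLast : ℕ → List ℕ → List ℕ
addLast r [] = []
addLast r (x ∷ []) = x + r ∷ []
addLast r (x ∷ y ∷ xs) = x ∷ addLast r (y ∷ xs)

-- characteristic sequence x_0,...,x_{b-1} of the necklace read cyclically
-- from the word: B_0 is the first black bead of the word; the gap after
-- the last black bead wraps around (trailing reds + leading reds).
charSeq : List Color → List ℕ
charSeq ws = addLast (leading ws) (gapsAfter ws)

-- list lookup with default 0
at : List ℕ → ℕ → ℕ
at [] i = 0
at (x ∷ xs) zero = x
at (x ∷ xs) (suc i) = at xs i

window : (b : ℕ) .{{_ : NonZero b}} → List ℕ → ℕ → ℕ → ℕ
window b xs i zero = 0
window b xs i (suc k) = at xs ((i + k) % b) + window b xs i k

-- regularity of the necklace given by a reading, with the rational
-- inequalities (a/b)k' - 1 < S < (a/b)k' + 1 multiplied through by b > 0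
Regular : (a b : ℕ) .{{_ : NonZero b}} → List Color → Set
Regular a b ws = ∀ i k' → i < b → 1 ≤ k' → k' ≤ 1 + b / 2 →
  let S = window b (charSeq ws) i k' in
  (a * k' < b * S + b) × (b * S < a * k' + b)

len : ℕ → Color → ℕ
len m red = m
len m black = 1

offset : ℕ → List Color → ℕ → ℕ
offset m ws zero = 0
offset m [] (suc p) = 0
offset m (c ∷ ws) (suc p) = len m c + offset m ws p

vertex : (n : ℕ) .{{_ : NonZero n}} → ℕ → List Color → ℕ → ℕ → ℕ
vertex n m ws v p = (v + offset m ws p) % n

pos+ : {a b : ℕ} → 0 < a → 0 < a + b
pos+ (s≤s z≤n) = s≤s z≤n

module Submission where

-- Write m = M + 1 and d = a + b, and read Δ as the word w of
-- length d.  Step p of C_{v,Δ} is the vertex v + off p (mod n), where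
-- off p = m·p − M·c(p) and c(p) counts the black beads among the first p.
-- Extending w periodically, its j-th black bead sits at
-- β j = ℓ + j + (x_0 + ⋯ + x_{j-1}) (ℓ leading reds, x the characteristic
-- sequence, indices mod b), and count P = #{ j | β j < P } agrees with c on
-- [0, d] and satisfies count (P + t·d) = count P + t·b.  As m·d − M·b = n, a
-- common vertex of C_{0,Δ} and C_{q(m-1),Δ} lifts to the exact identity
-- m·P + M·count p' = q·M + m·p' + M·count P with P = p + t·d.  Regularity,
-- first extended from short windows to windows of every length, says that an
-- interval of L beads with C black ones has d·C < b·L + d; together with
-- (q + 1)·d ≤ n this refutes the identity both when P ≥ p' and when P < p'.

open import Data.Nat using (ℕ; _+_; _*_; _∸_; _<_; _≤_; >-nonZero)
open import Data.Nat.DivMod using (_/_)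
open import Data.List using (List; length)
open import Relation.Binary.PropositionalEquality using (_≡_; _≢_)
open import Defs

open import Data.Nat using (zero; suc; z≤n; s≤s; NonZero; >-nonZero⁻¹; _≡ᵇ_)
open import Data.Nat.Properties
open import Data.Nat.DivMod using (_%_; m≡m%n+[m/n]*n; %-distribˡ-+; m%n%n≡m%n; [m+n]%n≡m%n; m<n⇒m%n≡m; m%n<n; m/n*n≤m)
open import Data.Nat.Tactic.RingSolver using (solve-∀)
open import Data.Nat.ListAction using (sum)
open import Data.List using ([]; _∷_)
open import Data.Product using (_×_; _,_; proj₁; proj₂; ∃)
open import Relation.Binary.PropositionalEquality hiding (_≡_; _≢_)
open import Relation.Nullary using (yes; no)
open import Function using (_∘_)
open import Data.Bool using (Bool; true; false; T)
open import Data.Bool.Properties using (¬-not)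
open import Data.Unit using (tt)
open import Data.Empty using (⊥; ⊥-elim)
open import Data.Sum using (_⊎_; inj₁; inj₂)
open import Relation.Binary.Definitions using (tri<; tri≈; tri>)
open import Algebra.Properties.CommutativeSemigroup +-commutativeSemigroup using (x∙yz≈y∙xz)

sumBelow : (ℕ → ℕ) → ℕ → ℕ
sumBelow f zero = 0
sumBelow f (suc k) = f k + sumBelow f k

sumBelow-suc : ∀ f k → sumBelow f (suc k) ≡ f 0 + sumBelow (f ∘ suc) k
sumBelow-suc f zero = refl
sumBelow-suc f (suc k) =
  trans (cong (f (suc k) +_) (sumBelow-suc f k)) (x∙yz≈y∙xz (f (suc k)) (f 0) _)

sumBelow-at : ∀ xs → sumBelow (at xs) (length xs) ≡ sum xs
sumBelow-at [] = refl
sumBelow-at (x ∷ xs) = trans (sumBelow-suc (at (x ∷ xs)) (length xs)) (cong (x +_) (sumBelow-at xs))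

sumBelow-cong : ∀ f g k → (∀ i → i < k → f i ≡ g i) → sumBelow f k ≡ sumBelow g k
sumBelow-cong f g zero h = refl
sumBelow-cong f g (suc k) h = cong₂ _+_ (h k ≤-refl) (sumBelow-cong f g k (λ i lt → h i (m<n⇒m<1+n lt)))

[m%n+k]%n≡[m+k]%n : ∀ i k b .{{_ : NonZero b}} → (i % b + k) % b ≡ (i + k) % b
[m%n+k]%n≡[m+k]%n i k b = begin
  (i % b + k) % b          ≡⟨ %-distribˡ-+ (i % b) k b ⟩
  (i % b % b + k % b) % b  ≡⟨ cong (λ x → (x + k % b) % b) (m%n%n≡m%n i b) ⟩
  (i % b + k % b) % b      ≡⟨ %-distribˡ-+ i k b ⟨
  (i + k) % b              ∎
  where open ≡-Reasoning

≢⇒≡ᵇ-false : ∀ {x y} → x ≢ y → (x ≡ᵇ y) ≡ false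
≢⇒≡ᵇ-false {x} {y} x≢y = ¬-not (λ hit → x≢y (≡ᵇ⇒≡ x y (subst T (sym hit) tt)))

module Windows (b : ℕ) .{{_ : NonZero b}} (xs : List ℕ) where

  win : ℕ → ℕ → ℕ
  win = window b xs

  win-split : ∀ i K₁ K₂ → win i (K₁ + K₂) ≡ win i K₁ + win (i + K₁) K₂
  win-split i K₁ zero = trans (cong (win i) (+-identityʳ K₁)) (sym (+-identityʳ _))
  win-split i K₁ (suc K₂) = begin
    win i (K₁ + suc K₂)                                  ≡⟨ cong (win i) (+-suc K₁ K₂) ⟩
    at xs ((i + (K₁ + K₂)) % b) + win i (K₁ + K₂)        ≡⟨ cong₂ _+_ (cong (λ z → at xs (z % b)) (sym (+-assoc i K₁ K₂)))
                                                                        (win-split i K₁ K₂) ⟩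
    at xs ((i + K₁ + K₂) % b) + (win i K₁ + win (i + K₁) K₂) ≡⟨ x∙yz≈y∙xz (at xs ((i + K₁ + K₂) % b)) (win i K₁) _ ⟩
    win i K₁ + win (i + K₁) (suc K₂)                     ∎
    where open ≡-Reasoning

  win-mod : ∀ i K → win (i % b) K ≡ win i K
  win-mod i zero = refl
  win-mod i (suc K) = cong₂ _+_ (cong (at xs) ([m%n+k]%n≡[m+k]%n i K b)) (win-mod i K)

  win-rotate : ∀ s → win s b ≡ win 0 b
  win-rotate zero = refl
  win-rotate (suc s) = trans rotate-once (win-rotate s)
    where
    one-period : win (s + b) 1 ≡ win s 1
    one-period = cong (λ z → at xs z + 0)
      (trans (cong (_% b) (+-identityʳ (s + b))) (trans ([m+n]%n≡m%n s b) (cong (_% b) (sym (+-identityʳ s)))))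
    rotate-once : win (suc s) b ≡ win s b
    rotate-once = +-cancelˡ-≡ (win s 1) _ _ (begin
      win s 1 + win (suc s) b   ≡⟨ cong (λ z → win s 1 + win z b) (+-comm 1 s) ⟩
      win s 1 + win (s + 1) b   ≡⟨ win-split s 1 b ⟨
      win s (1 + b)             ≡⟨ cong (win s) (+-comm 1 b) ⟩
      win s (b + 1)             ≡⟨ win-split s b 1 ⟩
      win s b + win (s + b) 1   ≡⟨ cong (win s b +_) one-period ⟩
      win s b + win s 1         ≡⟨ +-comm (win s b) _ ⟩
      win s 1 + win s b         ∎)
      where open ≡-Reasoning

  win-prefix : ∀ K → K ≤ b → win 0 K ≡ sumBelow (at xs) K
  win-prefix zero _ = refl
  win-prefix (suc K) le = cong₂ _+_ (cong (at xs) (m<n⇒m%n≡m le)) (win-prefix K (<⇒≤ le))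

  win-full : length xs ≡ b → ∀ s → win s b ≡ sum xs
  win-full len s = begin
    win s b                        ≡⟨ win-rotate s ⟩
    win 0 b                        ≡⟨ win-prefix b ≤-refl ⟩
    sumBelow (at xs) b             ≡⟨ cong (sumBelow (at xs)) len ⟨
    sumBelow (at xs) (length xs)   ≡⟨ sumBelow-at xs ⟩
    sum xs                         ∎
    where open ≡-Reasoning

complement-short : ∀ b K K' → K + K' ≡ b → 1 + b / 2 < K → K' ≤ 1 + b / 2
complement-short b K K' eq lt = +-cancelʳ-≤ (2 + h) K' (1 + h) (begin
    K' + (2 + h)        ≤⟨ +-monoʳ-≤ K' lt ⟩
    K' + K              ≡⟨ trans (+-comm K' K) eq ⟩
    b                   ≡⟨ m≡m%n+[m/n]*n b 2 ⟩
    b % 2 + h * 2       ≤⟨ +-monoˡ-≤ (h * 2) (≤-pred (m%n<n b 2)) ⟩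
    1 + h * 2           ≤⟨ m≤m+n (1 + h * 2) 2 ⟩
    1 + h * 2 + 2       ≡⟨ rearrange h ⟩
    (1 + h) + (2 + h)   ∎)
  where
  open ≤-Reasoning
  h : ℕ
  h = b / 2
  rearrange : ∀ h → 1 + h * 2 + 2 ≡ (1 + h) + (2 + h)
  rearrange = solve-∀

lower-from-complement : ∀ a b K K' S S' → K + K' ≡ b → S + S' ≡ a →
  b * S' < a * K' + b → a * K < b * S + b
lower-from-complement a b K K' S S' sumK sumS upper = +-cancelʳ-< (a * K') _ _ (begin-strict
  a * K + a * K'         ≡⟨ *-distribˡ-+ a K K' ⟨
  a * (K + K')           ≡⟨ cong (a *_) sumK ⟩
  a * b                  ≡⟨ *-comm a b ⟩
  b * a                  ≡⟨ cong (b *_) sumS ⟨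
  b * (S + S')           ≡⟨ *-distribˡ-+ b S S' ⟩
  b * S + b * S'         <⟨ +-monoʳ-< (b * S) upper ⟩
  b * S + (a * K' + b)   ≡⟨ rearrange (b * S) (a * K') b ⟩
  b * S + b + a * K'     ∎)
  where
  open ≤-Reasoning
  rearrange : ∀ x y z → x + (y + z) ≡ x + z + y
  rearrange = solve-∀

-- Regularity only constrains windows of length ≤ 1 + ⌊b/2⌋; together with the
-- fact that every full window sums to a it yields the lower bound a·K < b·S + b
-- for windows of every length K, which is all the main argument needs.
module Regularity (b : ℕ) .{{_ : NonZero b}} (xs : List ℕ) (a : ℕ)
  (full : ∀ s → window b xs s b ≡ a)
  (regular : ∀ i k' → i < b → 1 ≤ k' → k' ≤ 1 + b / 2 →
     (a * k' < b * window b xs i k' + b) × (b * window b xs i k' < a * k' + b)) where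
  open Windows b xs

  -- windows of length ≤ b: short ones are regular, a long one is the
  -- complement of a short one in a full period
  lower-bound-short : ∀ i K → i < b → K ≤ b → a * K < b * win i K + b
  lower-bound-short i zero _ _ rewrite *-zeroʳ a = ≤-trans (>-nonZero⁻¹ b) (m≤n+m b _)
  lower-bound-short i (suc K) i<b K≤b with suc K ≤? 1 + b / 2
  ... | yes short = proj₁ (regular i (suc K) i<b (s≤s z≤n) short)
  ... | no long with m≤n⇒∃[o]m+o≡n K≤b
  ...   | zero , K≡b rewrite +-identityʳ (suc K) | sym K≡b | full i | *-comm a (suc K) =
          m<m+n _ (s≤s z≤n)
  ...   | suc K'' , sumK = lower-from-complement a b (suc K) K' (win i (suc K)) S' sumK sumS upper
    where
    K' : ℕ
    K' = suc K''
    S' : ℕ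
    S' = win (i + suc K) K'
    sumS : win i (suc K) + S' ≡ a
    sumS = trans (sym (win-split i (suc K) K')) (trans (cong (win i) sumK) (full i))
    upper : b * S' < a * K' + b
    upper = subst (λ z → b * z < a * K' + b) (win-mod (i + suc K) K')
      (proj₂ (regular ((i + suc K) % b) K' (m%n<n _ b) (s≤s z≤n)
                      (complement-short b (suc K) K' sumK (≰⇒> long))))

  -- each additional full period adds a to the window sum and b to its length
  lower-bound-periods : ∀ t i r → r ≤ b → a * (t * b + r) < b * win i (t * b + r) + b
  lower-bound-periods zero i r r≤b =
    subst (λ z → a * r < b * z + b) (win-mod i r) (lower-bound-short (i % b) r (m%n<n i b) r≤b)
  lower-bound-periods (suc t) i r r≤b =
    subst (λ z → a * z < b * win i z + b) (sym (+-assoc b (t * b) r)) (begin-strict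
      a * (b + X)                ≡⟨ distribute a b X ⟩
      b * a + a * X              <⟨ +-monoʳ-< (b * a) (lower-bound-periods t (i + b) r r≤b) ⟩
      b * a + (b * W + b)        ≡⟨ +-assoc (b * a) _ b ⟨
      b * a + b * W + b          ≡⟨ cong (_+ b) (*-distribˡ-+ b a W) ⟨
      b * (a + W) + b            ≡⟨ cong (λ z → b * (z + W) + b) (full i) ⟨
      b * (win i b + W) + b      ≡⟨ cong (λ z → b * z + b) (win-split i b X) ⟨
      b * win i (b + X) + b      ∎)
    where
    open ≤-Reasoning
    X : ℕ
    X = t * b + r
    W : ℕ
    W = win (i + b) X
    distribute : ∀ x y z → x * (y + z) ≡ y * x + x * z
    distribute = solve-∀

  lower-bound : ∀ i K → a * K < b * win i K + b
  lower-bound i K = subst (λ z → a * z < b * win i z + b) (sym K≡)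
    (lower-bound-periods (K / b) i (K % b) (<⇒≤ (m%n<n K b)))
    where
    K≡ : K ≡ K / b * b + K % b
    K≡ = trans (m≡m%n+[m/n]*n K b) (+-comm (K % b) _)

bump : Bool → ℕ → ℕ
bump true c = suc c
bump false c = c

module Counting (β : ℕ → ℕ) (β-inc : ∀ j → β j < β (suc j)) where

  -- count P = #{ j | β j < P }: passing P raises the count iff P is the next term
  count : ℕ → ℕ
  count zero = 0
  count (suc P) = bump (β (count P) ≡ᵇ P) (count P)

  count-spec : ∀ P → (P ≤ β (count P)) × (∀ j → j < count P → β j < P)
  count-spec zero = z≤n , λ j ()
  count-spec (suc P) with β (count P) ≡ᵇ P in hit
  ... | true = next-above , below
    where
    β-hit : β (count P) ≡ P
    β-hit = ≡ᵇ⇒≡ _ _ (subst T (sym hit) tt)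
    next-above : suc P ≤ β (suc (count P))
    next-above = subst (λ z → suc z ≤ β (suc (count P))) β-hit (β-inc (count P))
    below : ∀ j → j < suc (count P) → β j < suc P
    below j (s≤s j≤c) with m≤n⇒m<n∨m≡n j≤c
    ... | inj₁ j<c = m<n⇒m<1+n (proj₂ (count-spec P) j j<c)
    ... | inj₂ refl = s≤s (≤-reflexive β-hit)
  ... | false = next-above , below
    where
    β-miss : β (count P) ≢ P
    β-miss eq = subst T hit (≡⇒≡ᵇ _ _ eq)
    next-above : suc P ≤ β (count P)
    next-above = ≤∧≢⇒< (proj₁ (count-spec P)) (λ eq → β-miss (sym eq))
    below : ∀ j → j < count P → β j < suc P
    below j j<c = m<n⇒m<1+n (proj₂ (count-spec P) j j<c)

  count-unique : ∀ P c → P ≤ β c → (∀ j → j < c → β j < P) → c ≡ count P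
  count-unique P c P≤βc below with <-cmp c (count P)
  ... | tri≈ _ eq _ = eq
  ... | tri< c<count _ _ = ⊥-elim (<-irrefl refl (<-≤-trans (proj₂ (count-spec P) c c<count) P≤βc))
  ... | tri> _ _ count<c = ⊥-elim (<-irrefl refl (<-≤-trans (below (count P) count<c) (proj₁ (count-spec P))))

  count-suc : ∀ P → count (suc P) ≡ count P ⊎ count (suc P) ≡ suc (count P)
  count-suc P with β (count P) ≡ᵇ P
  ... | false = inj₁ refl
  ... | true = inj₂ refl

  count-interval : ∀ P L → ∃ λ C → C ≤ L × count (P + L) ≡ count P + C
  count-interval P zero = 0 , z≤n , trans (cong count (+-identityʳ P)) (sym (+-identityʳ _))
  count-interval P (suc L) with count-interval P L | count-suc (P + L)
  ... | C , C≤L , eq | inj₁ same = C , m≤n⇒m≤1+n C≤L , trans (cong count (+-suc P L)) (trans same eq)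
  ... | C , C≤L , eq | inj₂ up =
    suc C , s≤s C≤L , trans (cong count (+-suc P L)) (trans up (trans (cong suc eq) (sym (+-suc _ C))))

  count-period : ∀ b d → (∀ j → β (j + b) ≡ β j + d) → count d ≡ b →
    ∀ t P → count (P + t * d) ≡ count P + t * b
  count-period b d β-period count-d = shift
    where
    shift-once : ∀ P → count (P + d) ≡ count P + b
    shift-once P = sym (count-unique (P + d) (count P + b) above below)
      where
      above : P + d ≤ β (count P + b)
      above = subst (P + d ≤_) (sym (β-period (count P))) (+-monoˡ-≤ d (proj₁ (count-spec P)))
      below : ∀ j → j < count P + b → β j < P + d
      below j j<c+b with j <? b
      ... | yes j<b = ≤-trans (proj₂ (count-spec d) j (subst (j <_) (sym count-d) j<b)) (m≤n+m d P)
      ... | no j≮b with m≤n⇒∃[o]m+o≡n (≮⇒≥ j≮b)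
      ...   | o , refl = subst (_< P + d) (sym (trans (cong β (+-comm b o)) (β-period o)))
                 (+-monoˡ-< d (proj₂ (count-spec P) o
                   (+-cancelʳ-< b o (count P) (subst (_< count P + b) (+-comm b o) j<c+b))))
    shift : ∀ t P → count (P + t * d) ≡ count P + t * b
    shift zero P = trans (cong count (+-identityʳ P)) (sym (+-identityʳ _))
    shift (suc t) P = begin
      count (P + (d + t * d))   ≡⟨ cong count (rearrange P d (t * d)) ⟩
      count (P + t * d + d)     ≡⟨ shift-once (P + t * d) ⟩
      count (P + t * d) + b     ≡⟨ cong (_+ b) (shift t P) ⟩
      count P + t * b + b       ≡⟨ rearrange (count P) b (t * b) ⟨
      count P + (b + t * b)     ∎
      where
      open ≡-Reasoning
      rearrange : ∀ x y z → x + (y + z) ≡ x + z + y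
      rearrange = solve-∀

  count-density : ∀ a b (S : ℕ → ℕ → ℕ) → 0 < a + b →
    (∀ j K → β (j + K) ≡ β j + K + S j K) → (∀ j K → a * K < b * S j K + b) →
    ∀ P L C → count (P + L) ≡ count P + C → (a + b) * C < b * L + (a + b)
  count-density a b S 0<d gaps dense P L zero _ rewrite *-zeroʳ (a + b) = ≤-trans 0<d (m≤n+m _ (b * L))
  count-density a b S 0<d gaps dense P L (suc K) count≡ = begin-strict
    (a + b) * suc K                   ≡⟨ expand a b K ⟩
    a * K + (b * suc K + a)           <⟨ +-monoˡ-< _ (dense j K) ⟩
    b * S j K + b + (b * suc K + a)   ≡⟨ collect a b K (S j K) ⟩
    b * (suc K + S j K) + (a + b)     ≤⟨ +-monoˡ-≤ (a + b) (*-monoʳ-≤ b span≤L) ⟩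
    b * L + (a + b)                   ∎
    where
    open ≤-Reasoning
    j : ℕ
    j = count P
    last-inside : β (j + K) < P + L
    last-inside = proj₂ (count-spec (P + L)) (j + K) (subst (j + K <_) (sym count≡) (+-monoʳ-< j (n<1+n K)))
    span≤L : suc K + S j K ≤ L
    span≤L = +-cancelˡ-≤ (β j) _ _ (begin
      β j + (suc K + S j K)   ≡⟨ +-suc (β j) _ ⟩
      suc (β j + (K + S j K)) ≡⟨ cong suc (+-assoc (β j) K _) ⟨
      suc (β j + K + S j K)   ≡⟨ cong suc (gaps j K) ⟨
      suc (β (j + K))         ≤⟨ last-inside ⟩
      P + L                   ≤⟨ +-monoˡ-≤ L (proj₁ (count-spec P)) ⟩
      β j + L                 ∎)
    expand : ∀ a b K → (a + b) * suc K ≡ a * K + (b * suc K + a)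
    expand = solve-∀
    collect : ∀ a b K s → b * s + b + (b * suc K + a) ≡ b * (suc K + s) + (a + b)
    collect = solve-∀

blacksBefore : List Color → ℕ → ℕ
blacksBefore [] p = 0
blacksBefore (c ∷ ws) zero = 0
blacksBefore (red ∷ ws) (suc p) = blacksBefore ws p
blacksBefore (black ∷ ws) (suc p) = suc (blacksBefore ws p)

-- position of the j-th black bead (from 0), given the number ℓ of leading red
-- beads and the list ys of gaps after the black beads: ℓ + j + y_0 + ⋯ + y_{j-1}
blackPos : ℕ → List ℕ → ℕ → ℕ
blackPos ℓ ys j = ℓ + j + sumBelow (at ys) j

blacksBefore-zero : ∀ w → blacksBefore w 0 ≡ 0
blacksBefore-zero [] = refl
blacksBefore-zero (c ∷ w) = refl

blacksBefore-all : ∀ w → blacksBefore w (length w) ≡ countBlack w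
blacksBefore-all [] = refl
blacksBefore-all (red ∷ ws) = blacksBefore-all ws
blacksBefore-all (black ∷ ws) = cong suc (blacksBefore-all ws)

blacksBefore-≤ : ∀ w p → blacksBefore w p ≤ countBlack w
blacksBefore-≤ [] p = z≤n
blacksBefore-≤ (c ∷ ws) zero = z≤n
blacksBefore-≤ (red ∷ ws) (suc p) = blacksBefore-≤ ws p
blacksBefore-≤ (black ∷ ws) (suc p) = s≤s (blacksBefore-≤ ws p)

blackPos-cons-black : ∀ y ys c → blackPos 0 (y ∷ ys) (suc c) ≡ suc (blackPos y ys c)
blackPos-cons-black y ys c = trans (cong (suc c +_) (sumBelow-suc (at (y ∷ ys)) c)) (rearrange c y _)
  where
  rearrange : ∀ c y s → suc (c + (y + s)) ≡ suc (y + c + s)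
  rearrange = solve-∀

-- Bead p is black exactly when the next black bead after the first p beads
-- sits at position p; so the number of black beads grows at bead p iff it does.
blacksBefore-suc : ∀ w p → p < length w →
  blacksBefore w (suc p) ≡ bump (blackPos (leading w) (gapsAfter w) (blacksBefore w p) ≡ᵇ p) (blacksBefore w p)
blacksBefore-suc (red ∷ ws) zero _ = blacksBefore-zero ws
blacksBefore-suc (black ∷ ws) zero _ = cong suc (blacksBefore-zero ws)
blacksBefore-suc (red ∷ ws) (suc p) (s≤s p<) = blacksBefore-suc ws p p<
blacksBefore-suc (black ∷ ws) (suc p) (s≤s p<) = begin
  suc (blacksBefore ws (suc p))            ≡⟨ cong suc (blacksBefore-suc ws p p<) ⟩
  suc (bump (hit (blackPos y ys c)) c)     ≡⟨ suc-bump (hit (blackPos y ys c)) c ⟩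
  bump (hit (blackPos y ys c)) (suc c)     ≡⟨ cong (λ x → bump (x ≡ᵇ suc p) (suc c)) (blackPos-cons-black y ys c) ⟨
  bump (blackPos 0 (y ∷ ys) (suc c) ≡ᵇ suc p) (suc c) ∎
  where
  open ≡-Reasoning
  c : ℕ
  c = blacksBefore ws p
  y : ℕ
  y = leading ws
  ys : List ℕ
  ys = gapsAfter ws
  hit : ℕ → Bool
  hit x = x ≡ᵇ p
  suc-bump : ∀ x c → suc (bump x c) ≡ bump x (suc c)
  suc-bump true c = refl
  suc-bump false c = refl

blackPos-end : ∀ w → blackPos (leading w) (gapsAfter w) (length (gapsAfter w)) ≡ length w
blackPos-end [] = refl
blackPos-end (red ∷ ws) = cong suc (blackPos-end ws)
blackPos-end (black ∷ ws) =
  trans (blackPos-cons-black (leading ws) (gapsAfter ws) _) (cong suc (blackPos-end ws))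

gapsAfter-length : ∀ w → length (gapsAfter w) ≡ countBlack w
gapsAfter-length [] = refl
gapsAfter-length (red ∷ ws) = gapsAfter-length ws
gapsAfter-length (black ∷ ws) = cong suc (gapsAfter-length ws)

gapsAfter-sum : ∀ w → sum (gapsAfter w) + leading w ≡ countRed w
gapsAfter-sum [] = refl
gapsAfter-sum (red ∷ ws) = trans (+-suc _ _) (cong suc (gapsAfter-sum ws))
gapsAfter-sum (black ∷ ws) = trans (+-identityʳ _) (trans (+-comm (leading ws) _) (gapsAfter-sum ws))

addLast-length : ∀ r xs → length (addLast r xs) ≡ length xs
addLast-length r [] = refl
addLast-length r (x ∷ []) = refl
addLast-length r (x ∷ y ∷ xs) = cong suc (addLast-length r (y ∷ xs))

addLast-sum : ∀ r x xs → sum (addLast r (x ∷ xs)) ≡ r + sum (x ∷ xs)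
addLast-sum r x [] = trans (cong (_+ 0) (+-comm x r)) (+-assoc r x 0)
addLast-sum r x (y ∷ xs) = trans (cong (x +_) (addLast-sum r y xs)) (x∙yz≈y∙xz x r _)

addLast-at : ∀ r xs i → suc i < length xs → at (addLast r xs) i ≡ at xs i
addLast-at r (x ∷ y ∷ xs) zero _ = refl
addLast-at r (x ∷ y ∷ xs) (suc i) (s≤s i<) = addLast-at r (y ∷ xs) i i<
addLast-at r (x ∷ []) i (s≤s ())

charSeq-length : ∀ w → length (charSeq w) ≡ countBlack w
charSeq-length w = trans (addLast-length (leading w) (gapsAfter w)) (gapsAfter-length w)

charSeq-sum : ∀ w → 0 < countBlack w → sum (charSeq w) ≡ countRed w
charSeq-sum w 0<b with gapsAfter w in gaps
... | [] = ⊥-elim (<-irrefl refl (subst (0 <_) (trans (sym (gapsAfter-length w)) (cong length gaps)) 0<b))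
... | x ∷ xs = begin
  sum (addLast (leading w) (x ∷ xs))  ≡⟨ addLast-sum (leading w) x xs ⟩
  leading w + sum (x ∷ xs)            ≡⟨ +-comm (leading w) _ ⟩
  sum (x ∷ xs) + leading w            ≡⟨ cong (λ z → sum z + leading w) gaps ⟨
  sum (gapsAfter w) + leading w       ≡⟨ gapsAfter-sum w ⟩
  countRed w                          ∎
  where open ≡-Reasoning

-- offset of bead p = m·p − (m − 1)·#(black beads before p), written with m = M + 1
offset-blacks : ∀ M w p → p ≤ length w → offset (suc M) w p + M * blacksBefore w p ≡ suc M * p
offset-blacks M [] zero _ = refl
offset-blacks M (c ∷ w) zero _ = refl
offset-blacks M (red ∷ ws) (suc p) (s≤s p≤) = begin
  suc M + offset (suc M) ws p + M * blacksBefore ws p    ≡⟨ +-assoc (suc M) _ _ ⟩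
  suc M + (offset (suc M) ws p + M * blacksBefore ws p)  ≡⟨ cong (suc M +_) (offset-blacks M ws p p≤) ⟩
  suc M + suc M * p                                      ≡⟨ *-suc (suc M) p ⟨
  suc M * suc p                                          ∎
  where open ≡-Reasoning
offset-blacks M (black ∷ ws) (suc p) (s≤s p≤) = begin
  suc (offset (suc M) ws p + M * suc (blacksBefore ws p))    ≡⟨ cong suc (rearrange _ M (blacksBefore ws p)) ⟩
  suc (M + (offset (suc M) ws p + M * blacksBefore ws p))    ≡⟨ cong (λ z → suc (M + z)) (offset-blacks M ws p p≤) ⟩
  suc M + suc M * p                                          ≡⟨ *-suc (suc M) p ⟨
  suc M * suc p                                              ∎
  where
  open ≡-Reasoning
  rearrange : ∀ o M c → o + M * suc c ≡ M + (o + M * c)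
  rearrange = solve-∀

offset-all : ∀ m w → offset m w (length w) ≡ m * countRed w + countBlack w
offset-all m [] = cong (_+ 0) (sym (*-zeroʳ m))
offset-all m (red ∷ ws) =
  trans (cong (m +_) (offset-all m ws)) (trans (sym (+-assoc m _ _)) (cong (_+ countBlack ws) (sym (*-suc m _))))
offset-all m (black ∷ ws) = trans (cong suc (offset-all m ws)) (sym (+-suc _ _))

offset-< : ∀ m w p → 0 < m → p < length w → offset m w p < offset m w (length w)
offset-< m (c ∷ ws) zero 0<m _ = ≤-trans (step-pos c) (m≤m+n _ _)
  where
  step-pos : ∀ c → 0 < len m c
  step-pos red = 0<m
  step-pos black = s≤s z≤n
offset-< m (c ∷ ws) (suc p) 0<m (s≤s p<) = +-monoʳ-< (len m c) (offset-< m ws p 0<m p<)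

-- The reading w of Δ extended periodically to all of ℕ.  With x = charSeq w,
-- its j-th black bead sits at β j = ℓ + j + (x_0 + ⋯ + x_{j-1}) (indices mod b),
-- where ℓ is the number of leading red beads, and count P is the number of
-- black beads before position P.
module PeriodicReading (a b : ℕ) .{{_ : NonZero b}} (w : List Color)
  (length-w : length w ≡ a + b) (reds : countRed w ≡ a) (blacks : countBlack w ≡ b) where

  open Windows b (charSeq w)

  ℓ : ℕ
  ℓ = leading w

  full-window : ∀ s → win s b ≡ a
  full-window s = trans (win-full (trans (charSeq-length w) blacks) s)
                        (trans (charSeq-sum w (subst (0 <_) (sym blacks) (>-nonZero⁻¹ b))) reds)

  β : ℕ → ℕ
  β j = ℓ + j + win 0 j

  β-gaps : ∀ j K → β (j + K) ≡ β j + K + win j K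
  β-gaps j K = trans (cong (ℓ + (j + K) +_) (win-split 0 j K)) (rearrange ℓ j K _ _)
    where
    rearrange : ∀ l j K x y → l + (j + K) + (x + y) ≡ l + j + x + K + y
    rearrange = solve-∀

  β-inc : ∀ j → β j < β (suc j)
  β-inc j = begin-strict
    β j                   <⟨ n<1+n (β j) ⟩
    suc (β j)             ≡⟨ +-comm 1 (β j) ⟩
    β j + 1               ≤⟨ m≤m+n (β j + 1) (win j 1) ⟩
    β j + 1 + win j 1     ≡⟨ β-gaps j 1 ⟨
    β (j + 1)             ≡⟨ cong β (+-comm j 1) ⟩
    β (suc j)             ∎
    where open ≤-Reasoning

  β-period : ∀ j → β (j + b) ≡ β j + (a + b)
  β-period j = trans (β-gaps j b) (trans (cong (β j + b +_) (full-window j)) (rearrange (β j) b a))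
    where
    rearrange : ∀ x b a → x + b + a ≡ x + (a + b)
    rearrange = solve-∀

  β-first-period : ∀ j → j < b → β j ≡ blackPos ℓ (gapsAfter w) j
  β-first-period j j<b = cong (ℓ + j +_) (trans (win-prefix j (<⇒≤ j<b))
    (sumBelow-cong _ _ j (λ i i<j → addLast-at ℓ (gapsAfter w) i
      (subst (suc i <_) (sym (trans (gapsAfter-length w) blacks)) (≤-<-trans i<j j<b)))))

  open Counting β β-inc public

  next-black-agrees : ∀ p → p < a + b →
    (β (blacksBefore w p) ≡ᵇ p) ≡ (blackPos ℓ (gapsAfter w) (blacksBefore w p) ≡ᵇ p)
  next-black-agrees p p<d with m≤n⇒m<n∨m≡n (subst (blacksBefore w p ≤_) blacks (blacksBefore-≤ w p))
  ... | inj₁ c<b = cong (_≡ᵇ p) (β-first-period _ c<b)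
  ... | inj₂ c≡b = trans (≢⇒≡ᵇ-false past-periodic) (sym (≢⇒≡ᵇ-false past-word))
    where
    -- after the last black bead, both "next" positions lie beyond the word
    past-periodic : β (blacksBefore w p) ≢ p
    past-periodic eq = <-irrefl (sym eq) (<-≤-trans p<d (begin
      a + b            ≡⟨ +-comm a b ⟩
      b + a            ≤⟨ m≤n+m (b + a) ℓ ⟩
      ℓ + (b + a)      ≡⟨ +-assoc ℓ b a ⟨
      ℓ + b + a        ≡⟨ cong (ℓ + b +_) (full-window 0) ⟨
      β b              ≡⟨ cong β c≡b ⟨
      β (blacksBefore w p) ∎))
      where open ≤-Reasoning
    past-word : blackPos ℓ (gapsAfter w) (blacksBefore w p) ≢ p
    past-word eq = <-irrefl (sym eq) (subst (p <_) (sym end) (subst (p <_) (sym length-w) p<d))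
      where
      end : blackPos ℓ (gapsAfter w) (blacksBefore w p) ≡ length w
      end = trans (cong (blackPos ℓ (gapsAfter w)) (trans c≡b (sym (trans (gapsAfter-length w) blacks))))
                  (blackPos-end w)

  count-agrees : ∀ p → p ≤ a + b → count p ≡ blacksBefore w p
  count-agrees zero _ = sym (blacksBefore-zero w)
  count-agrees (suc p) p<d = begin
    bump (β (count p) ≡ᵇ p) (count p)                     ≡⟨ cong (λ c → bump (β c ≡ᵇ p) c) (count-agrees p (<⇒≤ p<d)) ⟩
    bump (β c ≡ᵇ p) c                                     ≡⟨ cong (λ x → bump x c) (next-black-agrees p p<d) ⟩
    bump (blackPos ℓ (gapsAfter w) c ≡ᵇ p) c              ≡⟨ blacksBefore-suc w p (subst (p <_) (sym length-w) p<d) ⟨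
    blacksBefore w (suc p)                                ∎
    where
    open ≡-Reasoning
    c : ℕ
    c = blacksBefore w p

  count-shift : ∀ t P → count (P + t * (a + b)) ≡ count P + t * b
  count-shift = count-period b (a + b) β-period
    (trans (count-agrees (a + b) ≤-refl)
      (trans (cong (blacksBefore w) (sym length-w)) (trans (blacksBefore-all w) blacks)))

  black-density : Regular a b w → 0 < a + b →
    ∀ P L C → count (P + L) ≡ count P + C → (a + b) * C < b * L + (a + b)
  black-density regular 0<d =
    count-density a b win 0<d β-gaps (Regularity.lower-bound b (charSeq w) a full-window regular)

  offset-below : ∀ m n p → 0 < m → n ≡ a * m + b → p < a + b → offset m w p < n
  offset-below m n p 0<m n≡ p<d = subst (offset m w p <_) total (offset-< m w p 0<m (subst (p <_) (sym length-w) p<d))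
    where
    total : offset m w (length w) ≡ n
    total = trans (offset-all m w) (trans (cong₂ (λ r k → m * r + k) reds blacks)
                                          (trans (cong (_+ b) (*-comm m a)) (sym n≡)))

  -- A coincidence q·M + off p' = off p + t·n of offsets (m = M + 1) lifts to an
  -- exact identity between the extended offsets m·P − M·count P, using m·d = n + M·b.
  lift-coincidence : ∀ M n q t p p' → n ≡ a * suc M + b → p < a + b → p' < a + b →
    q * M + offset (suc M) w p' ≡ offset (suc M) w p + t * n →
    suc M * (p + t * (a + b)) + M * count p' ≡ q * M + suc M * p' + M * count (p + t * (a + b))
  lift-coincidence M n q t p p' n≡ p<d p'<d coincide = begin
    suc M * (p + t * d) + M * count p'                 ≡⟨ expand M p t d (count p') ⟩
    suc M * p + t * (suc M * d) + M * count p'         ≡⟨ cong₂ (λ x y → x + t * y + M * count p') (sym (at-bead p p<d)) md≡ ⟩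
    off p + M * count p + t * (n + M * b) + M * count p'   ≡⟨ regroup (off p) M (count p) t n b (count p') ⟩
    (off p + t * n) + M * count p' + M * (count p + t * b) ≡⟨ cong₂ (λ x y → x + M * count p' + M * y) (sym coincide) (sym (count-shift t p)) ⟩
    (q * M + off p') + M * count p' + M * count (p + t * d) ≡⟨ cong (_+ M * count (p + t * d)) (+-assoc (q * M) _ _) ⟩
    q * M + (off p' + M * count p') + M * count (p + t * d) ≡⟨ cong (λ x → q * M + x + M * count (p + t * d)) (at-bead p' p'<d) ⟩
    q * M + suc M * p' + M * count (p + t * d)          ∎
    where
    open ≡-Reasoning
    d : ℕ
    d = a + b
    off : ℕ → ℕ
    off = offset (suc M) w
    at-bead : ∀ p → p < d → off p + M * count p ≡ suc M * p
    at-bead p p<d = trans (cong (λ c → off p + M * c) (count-agrees p (<⇒≤ p<d)))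
                          (offset-blacks M w p (subst (p ≤_) (sym length-w) (<⇒≤ p<d)))
    md≡ : suc M * d ≡ n + M * b
    md≡ = trans (distribute a b M) (cong (_+ M * b) (sym n≡))
      where
      distribute : ∀ a b M → suc M * (a + b) ≡ a * suc M + b + M * b
      distribute = solve-∀
    expand : ∀ M p t d c' → suc M * (p + t * d) + M * c' ≡ suc M * p + t * (suc M * d) + M * c'
    expand = solve-∀
    regroup : ∀ o M c t n b c' → o + M * c + t * (n + M * b) + M * c' ≡ (o + t * n) + M * c' + M * (c + t * b)
    regroup = solve-∀

mod-lift : ∀ x y n .{{_ : NonZero n}} → y < n → y % n ≡ x % n → x ≡ y + (x / n) * n
mod-lift x y n y<n y≡x = trans (m≡m%n+[m/n]*n x n) (cong (_+ (x / n) * n) (trans (sym y≡x) (m<n⇒m%n≡m y<n)))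

below-quotient : ∀ n a b M q .{{_ : NonZero (a + b)}} → n ≡ a * suc M + b → q < n / (a + b) →
  q * (a + b) ≤ a * M
below-quotient n a b M q n≡ q<k = +-cancelˡ-≤ (a + b) _ _ (begin
  (a + b) + q * (a + b)   ≤⟨ *-monoˡ-≤ (a + b) q<k ⟩
  n / (a + b) * (a + b)   ≤⟨ m/n*n≤m n (a + b) ⟩
  n                       ≡⟨ n≡ ⟩
  a * suc M + b           ≡⟨ rearrange a b M ⟩
  (a + b) + a * M         ∎)
  where
  open ≤-Reasoning
  rearrange : ∀ a b M → a * suc M + b ≡ (a + b) + a * M
  rearrange = solve-∀

excess-below : ∀ M q ρ → 1 ≤ q → ρ + M * ρ ≤ q * M → ρ < q
excess-below M q zero 1≤q _ = 1≤q
excess-below M q (suc r) _ bound = *-cancelˡ-< M (suc r) q (begin-strict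
  M * suc r             <⟨ m<n+m (M * suc r) (s≤s z≤n) ⟩
  suc r + M * suc r     ≤⟨ bound ⟩
  q * M                 ≡⟨ *-comm q M ⟩
  M * q                 ∎)
  where open ≤-Reasoning

dense-window-impossible : ∀ a b M q C ρ → 1 ≤ q → q * (a + b) ≤ a * M →
  (C + ρ) + M * ρ ≡ q * M → (a + b) * C < b * (C + ρ) + (a + b) → ⊥
dense-window-impossible a b M q C ρ 1≤q qd≤aM balance dense = <-irrefl refl (begin-strict
  a * (C + ρ)       <⟨ reds-bound ⟩
  (a + b) * suc ρ   ≤⟨ *-monoʳ-≤ (a + b) ρ<q ⟩
  (a + b) * q       ≡⟨ *-comm (a + b) q ⟩
  q * (a + b)       ≤⟨ qd≤aM ⟩
  a * M             ≤⟨ *-monoʳ-≤ a M≤L ⟩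
  a * (C + ρ)       ∎)
  where
  open ≤-Reasoning
  ρ+Mρ≤qM : ρ + M * ρ ≤ q * M
  ρ+Mρ≤qM = subst (ρ + M * ρ ≤_) balance (+-monoˡ-≤ (M * ρ) (m≤n+m ρ C))
  ρ<q : ρ < q
  ρ<q = excess-below M q ρ 1≤q ρ+Mρ≤qM
  M≤L : M ≤ C + ρ
  M≤L = +-cancelʳ-≤ (M * ρ) M (C + ρ) (begin
    M + M * ρ         ≡⟨ *-suc M ρ ⟨
    M * suc ρ         ≤⟨ *-monoʳ-≤ M ρ<q ⟩
    M * q             ≡⟨ *-comm M q ⟩
    q * M             ≡⟨ balance ⟨
    C + ρ + M * ρ     ∎)
  reds-bound : a * (C + ρ) < (a + b) * suc ρ
  reds-bound = +-cancelʳ-< (b * C) _ _ (begin-strict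
    a * (C + ρ) + b * C                  ≡⟨ split a b C ρ ⟩
    (a + b) * C + a * ρ                  <⟨ +-monoˡ-< (a * ρ) dense ⟩
    b * (C + ρ) + (a + b) + a * ρ        ≡⟨ collect a b C ρ ⟩
    (a + b) * suc ρ + b * C              ∎)
    where
    split : ∀ a b C ρ → a * (C + ρ) + b * C ≡ (a + b) * C + a * ρ
    split = solve-∀
    collect : ∀ a b C ρ → b * (C + ρ) + (a + b) + a * ρ ≡ (a + b) * suc ρ + b * C
    collect = solve-∀

forward-balance : ∀ M P' c C ρ Q → suc M * (P' + (C + ρ)) + M * c ≡ Q + suc M * P' + M * (c + C) →
  (C + ρ) + M * ρ ≡ Q
forward-balance M P' c C ρ Q identity = +-cancelʳ-≡ (suc M * P' + M * c + M * C) _ _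
  (trans (expand M P' c C ρ) (trans identity (regroup M P' c C Q)))
  where
  expand : ∀ M P' c C ρ → (C + ρ) + M * ρ + (suc M * P' + M * c + M * C) ≡ suc M * (P' + (C + ρ)) + M * c
  expand = solve-∀
  regroup : ∀ M P' c C Q → Q + suc M * P' + M * (c + C) ≡ Q + (suc M * P' + M * c + M * C)
  regroup = solve-∀

-- Backward case: P' = P + (D + 1) with B P' = B P + C', C' ≤ D + 1, would need
-- M·C' = Q + m·(D + 1), but the left side is the smaller one.
backward-impossible : ∀ M P c D C' Q → C' ≤ suc D →
  suc M * P + M * (c + C') ≡ Q + suc M * (P + suc D) + M * c → ⊥
backward-impossible M P c D C' Q C'≤ identity = <-irrefl refl (begin-strict
  M * C'              ≤⟨ *-monoʳ-≤ M C'≤ ⟩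
  M * suc D           <⟨ s≤s (m≤n+m (M * suc D) D) ⟩
  suc M * suc D       ≤⟨ m≤n+m _ Q ⟩
  Q + suc M * suc D   ≡⟨ balance ⟨
  M * C'              ∎)
  where
  open ≤-Reasoning
  balance : M * C' ≡ Q + suc M * suc D
  balance = +-cancelʳ-≡ (suc M * P + M * c) _ _
    (trans (expand M P c C') (trans identity (regroup M P c (suc D) Q)))
    where
    expand : ∀ M P c C' → M * C' + (suc M * P + M * c) ≡ suc M * P + M * (c + C')
    expand = solve-∀
    regroup : ∀ M P c D Q → Q + suc M * (P + D) + M * c ≡ Q + suc M * D + (suc M * P + M * c)
    regroup = solve-∀

no-offset-coincidence : ∀ a b M q (B : ℕ → ℕ) → 1 ≤ q → q * (a + b) ≤ a * M →
  (∀ P L → ∃ λ C → C ≤ L × B (P + L) ≡ B P + C) →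
  (∀ P L C → B (P + L) ≡ B P + C → (a + b) * C < b * L + (a + b)) →
  ∀ P P' → suc M * P + M * B P' ≢ q * M + suc M * P' + M * B P
no-offset-coincidence a b M q B 1≤q qd≤aM interval density P P' identity with P' ≤? P
... | yes P'≤P with m≤n⇒∃[o]m+o≡n P'≤P
...   | L , refl with interval P' L
...     | C , C≤L , grows with m≤n⇒∃[o]m+o≡n C≤L
...       | ρ , refl = dense-window-impossible a b M q C ρ 1≤q qd≤aM
             (forward-balance M P' (B P') C ρ (q * M)
               (subst (λ c → suc M * (P' + (C + ρ)) + M * B P' ≡ q * M + suc M * P' + M * c) grows identity))
             (density P' (C + ρ) C grows)
no-offset-coincidence a b M q B 1≤q qd≤aM interval density P P' identity | no P'≰P
  with m≤n⇒∃[o]m+o≡n (≰⇒> P'≰P)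
... | D , refl with interval P (suc D)
...   | C' , C'≤ , grows = backward-impossible M P (B P) D C' (q * M) C'≤
          (subst₂ (λ x c → suc M * P + M * c ≡ q * M + suc M * x + M * B P) (sym (+-suc P D)) grows' identity)
  where
  grows' : B (suc P + D) ≡ B P + C'
  grows' = trans (cong B (sym (+-suc P D))) grows

theorem8 : (n m a b : ℕ) (hn : 0 < n) → 0 < m → n ≡ a * m + b →
    (ha : 0 < a) (hb : 0 < b) → b < m →
    (w : List Color) → length w ≡ a + b →
    countRed w ≡ a → countBlack w ≡ b →
    Regular a b {{>-nonZero hb}} w →
    (q : ℕ) → 1 ≤ q → q < _/_ n (a + b) {{>-nonZero (pos+ ha)}} →
    (p p' : ℕ) → p < a + b → p' < a + b →
    vertex n {{>-nonZero hn}} m w 0 p ≢ vertex n {{>-nonZero hn}} m w (q * (m ∸ 1)) p'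
theorem8 n (suc M) a b hn 0<m n≡ ha hb _ w length-w reds blacks regular q 1≤q q<k p p' p<d p'<d coincide =
  no-offset-coincidence a b M q count 1≤q (below-quotient n a b M q n≡ q<k)
    count-interval (black-density regular (pos+ ha)) (p + t * (a + b)) p'
    (lift-coincidence M n q t p p' n≡ p<d p'<d shifted≡)
  where
  instance
    _ : NonZero n
    _ = >-nonZero hn
    _ : NonZero b
    _ = >-nonZero hb
    _ : NonZero (a + b)
    _ = >-nonZero (pos+ ha)
  open PeriodicReading a b w length-w reds blacks
  off : ℕ → ℕ
  off = offset (suc M) w
  -- the vertex of C_{q(m-1),Δ} at step p', taken before reduction modulo n
  shifted : ℕ
  shifted = q * M + off p'
  t : ℕ
  t = shifted / n
  shifted≡ : shifted ≡ off p + t * n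
  shifted≡ = mod-lift shifted (off p) n (offset-below (suc M) n p 0<m n≡ p<d) coincide
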